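{- A maximal independent set can be computed deterministically in $O(\log^*(\Delta r))$ rounds in the $\mathsf{LOCAL}$ model on hypergraphs with maximum degree $\Delta=2$ and rank $r$, assuming that a coloring of the nodes with $O((\Delta r)^2)$ colors is given as input.
   Context: A hypergraph $H=(V,E)$ has node set $V$ and hyperedges $E\subseteq 2^V$; $\Delta$ is the maximum number of hyperedges containing a node and $r=\max_e|e|$ the rank. An independent set is a set $S\subseteq V$ such that no hyperedge is fully contained in $S$; a maximal independent set is an inclusion-wise maximal one. The input coloring is a proper coloring of the nodes in the sense that nodes sharing a hyperedge receive different colors. In the $\mathsf{LOCAL}$ model nodes have unique IDs, know their degree, $\Delta$, $r$ and $n$, and in synchronous rounds exchange unbounded messages with nodes sharing a hyperedge. -}

module Defs where

open import Data.Nat using (ℕ; zero; suc; _+_; _*_; _^_; _≤_; _<_; _≤?_)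
open import Data.Nat.Logarithm using (⌊log₂_⌋)
open import Data.Bool using (Bool; true)
open import Data.Fin using (Fin; _≟_)
open import Data.Fin.Subset using (Subset; _∈_; _∉_; _⊆_; ∣_∣; Nonempty)
open import Data.Fin.Subset.Properties using (_∈?_)
open import Data.List using (List; []; _∷_; filter; length; map; allFin)
open import Data.List.Relation.Unary.All using (All)
open import Data.List.Relation.Unary.Any using (Any)
open import Data.List.Relation.Unary.Unique.Propositional using (Unique)
open import Data.List.Relation.Binary.Pointwise using (Pointwise)
open import Data.List.Relation.Binary.Permutation.Propositional using (_↭_)
open import Data.List.Membership.Propositional using () renaming (_∈_ to _∈ₗ_)
open import Data.Vec using (tabulate)
open import Data.Product using (Σ; ∃; _×_)
open import Relation.Nullary using (¬_; ¬?)
open import Relation.Binary.PropositionalEquality using (_≡_; _≢_)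

-- Iterated logarithm log*(x): number of times ⌊log₂⌋ must be applied
-- to x until the value is ≤ 1.  (Fuel x suffices since ⌊log₂ x⌋ < x.)

logStarAux : ℕ → ℕ → ℕ
logStarAux zero    x = 0
logStarAux (suc f) x with x ≤? 1
... | Relation.Nullary.yes _ = 0
... | Relation.Nullary.no  _ = suc (logStarAux f ⌊log₂ x ⌋)

log* : ℕ → ℕ
log* x = logStarAux x x

record Hypergraph (n : ℕ) : Set where
  field
    edges    : List (Subset n)
    distinct : Unique edges
    nonempty : All Nonempty edges
open Hypergraph public

module _ {n : ℕ} (H : Hypergraph n) where

  incident : Fin n → List (Subset n)
  incident v = filter (v ∈?_) (edges H)

  degree : Fin n → ℕ
  degree v = length (incident v)

  MaxDegree : ℕ → Set
  MaxDegree Δ = (∀ v → degree v ≤ Δ) × (∃ λ v → degree v ≡ Δ)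

  Rank : ℕ → Set
  Rank r = All (λ e → ∣ e ∣ ≤ r) (edges H) × Any (λ e → ∣ e ∣ ≡ r) (edges H)

  Independent : Subset n → Set
  Independent S = All (λ e → ¬ (e ⊆ S)) (edges H)

  MaximalIndependent : Subset n → Set
  MaximalIndependent S =
    Independent S × (∀ T → S ⊆ T → Independent T → T ⊆ S)

  ProperColoring : (Fin n → ℕ) → Set
  ProperColoring col =
    ∀ e → e ∈ₗ edges H → ∀ u v → u ∈ e → v ∈ e → u ≢ v → col u ≢ col v

-- In each round a node receives, for every incident
-- hyperedge, the states of the other nodes of that hyperedge (unbounded
-- messages = full states).  Since the network imposes no order on
-- incident hyperedges or on the nodes within a hyperedge, the transition
-- function is required to be invariant under reordering of both.

_≈ₘ_ : {S : Set} → List (List S) → List (List S) → Set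
xs ≈ₘ ys = ∃ λ zs → Pointwise _↭_ xs zs × zs ↭ ys

record LocalAlg : Set₁ where
  field
    State   : Set
    init    : (n Δ r ident color deg : ℕ) → State
    step    : State → List (List State) → State
    step-inv : ∀ s xs ys → xs ≈ₘ ys → step s xs ≡ step s ys
    rounds  : (n Δ r : ℕ) → ℕ
    output  : State → Bool            -- true = node joins the set
open LocalAlg public

module _ (A : LocalAlg) {n : ℕ} (H : Hypergraph n) (Δ r : ℕ)
         (ident : Fin n → ℕ) (col : Fin n → ℕ) where

  members : Subset n → List (Fin n)
  members e = filter (_∈? e) (allFin n)

  others : Subset n → Fin n → List (Fin n)
  others e v = filter (λ u → ¬? (u ≟ v)) (members e)

  run : ℕ → Fin n → State A
  run zero    v = init A n Δ r (ident v) (col v) (degree H v)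
  run (suc t) v = step A (run t v) (map (λ e → map (run t) (others e v)) (incident H v))

  outputSet : Subset n
  outputSet = tabulate (λ v → output A (run (rounds A n Δ r) v))

Injective : {n : ℕ} → (Fin n → ℕ) → Set
Injective f = ∀ u v → f u ≡ f v → u ≡ v

-- A node heads a hyperedge if it has the smallest colour in it; the leaders, the nodes heading some
-- hyperedge, meet every hyperedge. With Δ = 2 a leader heads all but at most one of its hyperedges,
-- and linking it to the head of that one gives a forest of leaders in which colours decrease towards
-- the roots. log*(2r) Cole–Vishkin rounds on this forest relabel the leaders properly with 2^(5+C)
-- labels. The leaders are then thinned to a minimal transversal, one label class per two rounds: a
-- leader of the current label each of whose hyperedges has another member in the transversal becomes
-- a candidate, and a candidate leaves if it heads, or shares with a remaining non-candidate or with
-- a candidate of smaller colour, each of its hyperedges. A head that leaves has a child in its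
-- hyperedge, which carries another label and stays, so every hyperedge stays covered; a candidate
-- that stays keeps a hyperedge covered by it alone. The complement of a minimal transversal is a
-- maximal independent set.

module Submission where

open import Defs
open import Algebra.Definitions using (Commutative; Associative)
open import Data.Bool using (Bool; true; false; T; _∧_; _∨_; not; if_then_else_)
import Data.Bool as Bool
open import Data.Bool.ListAction using (any; all; or; and)
open import Data.Bool.Properties using (∨-comm; ∨-assoc; ∧-comm; ∧-assoc; T-∧; T-∨; T-≡)
open import Data.Empty using (⊥-elim)
open import Data.Fin using (Fin) renaming (_≟_ to _≟ᶠ_)
open import Data.Fin.Subset using (Subset; _∈_; _⊆_)
open import Data.Fin.Subset.Properties using (_∈?_)
open import Data.List using (List; []; _∷_; foldr; map; length; allFin)
open import Data.List.Extrema.Nat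
  using (min; max; argmin; argmin-sel; f[argmin]≤f[xs]; min≤xs; v<min⁺; min-mono-⊆; max-mono-⊆; min≈v⁺; max≈v⁺)
open import Data.List.Membership.Propositional using (find; lose) renaming (_∈_ to _∈ₗ_)
open import Data.List.Membership.Propositional.Properties using (∈-map⁺; ∈-filter⁺; ∈-filter⁻; ∈-allFin)
open import Data.List.Properties using (map-∘; map-cong)
open import Data.List.Relation.Binary.Permutation.Propositional using (_↭_; ↭-sym)
import Data.List.Relation.Binary.Permutation.Propositional as ↭
open import Data.List.Relation.Binary.Permutation.Propositional.Properties using (∈-resp-↭; map⁺)
open import Data.List.Relation.Binary.Pointwise using (Pointwise-≡⇒≡)
import Data.List.Relation.Binary.Pointwise as Pointwise
open import Data.List.Relation.Unary.All using (All)
import Data.List.Relation.Unary.All as All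
open import Data.List.Relation.Unary.All.Properties using (all⁺; all⁻)
import Data.List.Relation.Unary.All.Properties as Allₚ
open import Data.List.Relation.Unary.All.Properties.Core using (¬All⇒Any¬)
open import Data.List.Relation.Unary.Any using (here; there; any?)
open import Data.List.Relation.Unary.Any.Properties using (any⁺; any⁻)
import Data.List.Relation.Unary.Any.Properties as Anyₚ
open import Data.Nat
  using (ℕ; zero; suc; _+_; _*_; _^_; _≤_; _<_; _∸_; _<ᵇ_; _≡ᵇ_; _%_; _/_; ⌊_/2⌋; _≟_; _≤?_; _<?_; z≤n; s≤s)
open import Data.Nat.DivMod using (m≡m%n+[m/n]*n; m%n<n; m<n*o⇒m/o<n)
open import Data.Nat.GeneralisedArithmetic using (iterate; iterate-is-fold)
open import Data.Nat.Induction using (<-rec)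
open import Data.Nat.Logarithm using (⌊log₂_⌋; ⌊log₂⌋-mono-≤; ⌊log₂[2^n]⌋≡n; ⌊log₂⌊n/2⌋⌋≡⌊log₂n⌋∸1)
open import Data.Nat.Properties
open import Data.Nat.Tactic.RingSolver using (solve-∀)
open import Data.Product using (Σ; ∃; _×_; _,_; proj₁; proj₂)
open import Data.Sum using (_⊎_; inj₁; inj₂)
open import Data.Vec.Properties using (≡-dec; lookup⇒[]=; []=⇒lookup; lookup∘tabulate)
open import Function.Bundles using (module Equivalence)
open import Relation.Binary.Core using (_Preserves_⟶_)
open import Relation.Binary.PropositionalEquality
  using (_≡_; _≢_; refl; sym; trans; cong; cong₂; subst; subst₂; module ≡-Reasoning)
open import Relation.Nullary using (¬_; ¬?; yes; no)
open import Relation.Nullary.Decidable using (decidable-stable; T?)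

module _ {A : Set} (_∙_ : A → A → A) (comm : Commutative _≡_ _∙_) (assoc : Associative _≡_ _∙_) where

  foldr-↭ : ∀ e {xs ys} → xs ↭ ys → foldr _∙_ e xs ≡ foldr _∙_ e ys
  foldr-↭ e ↭.refl = refl
  foldr-↭ e (↭.prep x p) = cong (x ∙_) (foldr-↭ e p)
  foldr-↭ e (↭.swap {xs} {ys} x y p) = begin
    x ∙ (y ∙ foldr _∙_ e xs)  ≡⟨ cong (λ z → x ∙ (y ∙ z)) (foldr-↭ e p) ⟩
    x ∙ (y ∙ foldr _∙_ e ys)  ≡⟨ assoc x y _ ⟨
    (x ∙ y) ∙ foldr _∙_ e ys  ≡⟨ cong (_∙ foldr _∙_ e ys) (comm x y) ⟩
    (y ∙ x) ∙ foldr _∙_ e ys  ≡⟨ assoc y x _ ⟩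
    y ∙ (x ∙ foldr _∙_ e ys)  ∎
    where open ≡-Reasoning
  foldr-↭ e (↭.trans p q) = trans (foldr-↭ e p) (foldr-↭ e q)

min-↭ : ∀ b {xs ys} → xs ↭ ys → min b xs ≡ min b ys
min-↭ b p = ≤-antisym (min-mono-⊆ ≤-refl (∈-resp-↭ (↭-sym p))) (min-mono-⊆ ≤-refl (∈-resp-↭ p))

max-↭ : ∀ b {xs ys} → xs ↭ ys → max b xs ≡ max b ys
max-↭ b p = ≤-antisym (max-mono-⊆ ≤-refl (∈-resp-↭ p)) (max-mono-⊆ ≤-refl (∈-resp-↭ (↭-sym p)))

module _ {S A : Set} (F : List S → A) (F-↭ : F Preserves _↭_ ⟶ _≡_) where

  map-≈ₘ : ∀ {xs ys} → xs ≈ₘ ys → map F xs ↭ map F ys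
  map-≈ₘ {xs} {ys} (zs , xs∼zs , zs↭ys) =
    subst (_↭ map F ys) (sym (Pointwise-≡⇒≡ (Pointwise.map⁺ F F (Pointwise.map F-↭ xs∼zs)))) (map⁺ F zs↭ys)

module _ {S : Set} where

  any-≈ₘ : (F : List S → Bool) → F Preserves _↭_ ⟶ _≡_ → ∀ {xs ys} → xs ≈ₘ ys → any F xs ≡ any F ys
  any-≈ₘ F F-↭ q = foldr-↭ _∨_ ∨-comm ∨-assoc false (map-≈ₘ F F-↭ q)

  all-≈ₘ : (F : List S → Bool) → F Preserves _↭_ ⟶ _≡_ → ∀ {xs ys} → xs ≈ₘ ys → all F xs ≡ all F ys
  all-≈ₘ F F-↭ q = foldr-↭ _∧_ ∧-comm ∧-assoc true (map-≈ₘ F F-↭ q)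

  max-≈ₘ : (F : List S → ℕ) → F Preserves _↭_ ⟶ _≡_ → ∀ {xs ys} → xs ≈ₘ ys →
           max 0 (map F xs) ≡ max 0 (map F ys)
  max-≈ₘ F F-↭ q = max-↭ 0 (map-≈ₘ F F-↭ q)

module _ {A : Set} where

  distinct⇒2≤length : ∀ {b c : A} xs → b ∈ₗ xs → c ∈ₗ xs → b ≢ c → 2 ≤ length xs
  distinct⇒2≤length (_ ∷ _ ∷ _) (here refl) (there _)   _   = s≤s (s≤s z≤n)
  distinct⇒2≤length (_ ∷ _ ∷ _) (there _)   _           _   = s≤s (s≤s z≤n)
  distinct⇒2≤length (_ ∷ _)     (here refl) (here refl) b≢c = ⊥-elim (b≢c refl)
  distinct⇒2≤length (_ ∷ [])    (there ())  _           _

  distinct⇒3≤length : ∀ {a b c : A} xs → a ∈ₗ xs → b ∈ₗ xs → c ∈ₗ xs → a ≢ b → a ≢ c → b ≢ c → 3 ≤ length xs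
  distinct⇒3≤length (_ ∷ xs) (here refl) (here refl) _           a≢b _   _   = ⊥-elim (a≢b refl)
  distinct⇒3≤length (_ ∷ xs) (here refl) _           (here refl) _   a≢c _   = ⊥-elim (a≢c refl)
  distinct⇒3≤length (_ ∷ xs) _           (here refl) (here refl) _   _   b≢c = ⊥-elim (b≢c refl)
  distinct⇒3≤length (_ ∷ xs) (here refl) (there b∈) (there c∈)  _   _   b≢c = s≤s (distinct⇒2≤length xs b∈ c∈ b≢c)
  distinct⇒3≤length (_ ∷ xs) (there a∈) (here refl) (there c∈)  _   a≢c _   = s≤s (distinct⇒2≤length xs a∈ c∈ a≢c)
  distinct⇒3≤length (_ ∷ xs) (there a∈) (there b∈) (here refl)  a≢b _   _   = s≤s (distinct⇒2≤length xs a∈ b∈ a≢b)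
  distinct⇒3≤length (_ ∷ xs) (there a∈) (there b∈) (there c∈)   a≢b a≢c b≢c =
    ≤-trans (distinct⇒3≤length xs a∈ b∈ c∈ a≢b a≢c b≢c) (n≤1+n _)

  min-map≡ : (f : A → ℕ) {d : ℕ} {xs : List A} {y : A} → y ∈ₗ xs → (∀ {x} → x ∈ₗ xs → f y ≤ f x) → f y ≤ d →
             min d (map f xs) ≡ f y
  min-map≡ f y∈ least fy≤d = min≈v⁺ (∈-map⁺ f y∈) (Allₚ.map⁺ (All.tabulate least)) fy≤d

  max-map≡ : (f : A → ℕ) {xs : List A} {y : A} {v : ℕ} → y ∈ₗ xs → f y ≡ v → (∀ {x} → x ∈ₗ xs → f x ≤ v) →
             max 0 (map f xs) ≡ v
  max-map≡ f y∈ fy≡v bounded = max≈v⁺ (subst (_∈ₗ _) fy≡v (∈-map⁺ f y∈)) (Allₚ.map⁺ (All.tabulate bounded)) z≤n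

module _ {A : Set} {x y : A} where

  if-T : ∀ {b} → T b → (if b then x else y) ≡ x
  if-T {true} _ = refl

  if-¬T : ∀ {b} → ¬ T b → (if b then x else y) ≡ y
  if-¬T {true}  ¬t = ⊥-elim (¬t _)
  if-¬T {false} _  = refl

T-not⁻ : ∀ {b} → T (not b) → ¬ T b
T-not⁻ {true} ()

T-not⁺ : ∀ {b} → ¬ T b → T (not b)
T-not⁺ {true}  ¬t = ¬t _
T-not⁺ {false} _  = _

-- Cole–Vishkin colour reduction

cvLabel : ℕ → ℕ → ℕ → ℕ
cvLabel zero    a b = 0
cvLabel (suc f) a b with a % 2 ≟ b % 2
... | yes _ = 2 + cvLabel f (a / 2) (b / 2)
... | no  _ = a % 2

private
  halves-≢ : ∀ {a b} → a % 2 ≡ b % 2 → a ≢ b → a / 2 ≢ b / 2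
  halves-≢ {a} {b} same-bit a≢b halves-≡ = a≢b (begin
    a                      ≡⟨ m≡m%n+[m/n]*n a 2 ⟩
    a % 2 + (a / 2) * 2    ≡⟨ cong₂ (λ x y → x + y * 2) same-bit halves-≡ ⟩
    b % 2 + (b / 2) * 2    ≡⟨ m≡m%n+[m/n]*n b 2 ⟨
    b                      ∎)
    where open ≡-Reasoning

  half-< : ∀ {a} f → a < 2 ^ suc f → a / 2 < 2 ^ f
  half-< {a} f a< = m<n*o⇒m/o<n {a} {2 ^ f} {2} (subst (a <_) (*-comm 2 (2 ^ f)) a<)

  <2^0⇒≡0 : ∀ {a} → a < 2 ^ zero → a ≡ 0
  <2^0⇒≡0 (s≤s z≤n) = refl

  bit<2 : ∀ a → a % 2 < 2
  bit<2 a = m%n<n a 2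

cvLabel-< : ∀ f {a b} → a < 2 ^ f → b < 2 ^ f → a ≢ b → cvLabel f a b < 2 * f
cvLabel-< zero a< b< a≢b = ⊥-elim (a≢b (trans (<2^0⇒≡0 a<) (sym (<2^0⇒≡0 b<))))
cvLabel-< (suc f) {a} {b} a< b< a≢b with a % 2 ≟ b % 2
... | yes same = begin-strict
  2 + cvLabel f (a / 2) (b / 2)  <⟨ +-monoʳ-< 2 (cvLabel-< f (half-< f a<) (half-< f b<) (halves-≢ same a≢b)) ⟩
  2 + 2 * f                      ≡⟨ *-suc 2 f ⟨
  2 * suc f                      ∎
  where open ≤-Reasoning
... | no _ = ≤-trans (bit<2 a) (*-monoʳ-≤ 2 (s≤s z≤n))

-- a, b and c are the labels of a node, its parent and its grandparent.
cvLabel-≢ : ∀ f {a b c} → a < 2 ^ f → b < 2 ^ f → c < 2 ^ f → a ≢ b → b ≢ c → cvLabel f a b ≢ cvLabel f b c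
cvLabel-≢ zero a< b< c< a≢b _ = ⊥-elim (a≢b (trans (<2^0⇒≡0 a<) (sym (<2^0⇒≡0 b<))))
cvLabel-≢ (suc f) {a} {b} {c} a< b< c< a≢b b≢c with a % 2 ≟ b % 2 | b % 2 ≟ c % 2
... | yes ab | yes bc = λ eq → cvLabel-≢ f (half-< f a<) (half-< f b<) (half-< f c<)
                                  (halves-≢ ab a≢b) (halves-≢ bc b≢c) (suc-injective (suc-injective eq))
... | yes _  | no _   = λ eq → <⇒≢ (≤-trans (bit<2 b) (m≤m+n 2 _)) (sym eq)
... | no _   | yes _  = λ eq → <⇒≢ (≤-trans (bit<2 a) (m≤m+n 2 _)) eq
... | no ab  | no _   = ab

-- The fictitious parent colour of a root.
flipLowBit : ℕ → ℕ
flipLowBit zero          = 1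
flipLowBit (suc zero)    = 0
flipLowBit (suc (suc a)) = suc (suc (flipLowBit a))

flipLowBit-≢ : ∀ a → a ≢ flipLowBit a
flipLowBit-≢ (suc (suc a)) eq = flipLowBit-≢ a (suc-injective (suc-injective eq))

flipLowBit-<-*2 : ∀ {a m} → a < m * 2 → flipLowBit a < m * 2
flipLowBit-<-*2 {zero}        {suc m} _                 = s≤s (s≤s z≤n)
flipLowBit-<-*2 {suc zero}    {suc m} _                 = s≤s z≤n
flipLowBit-<-*2 {suc (suc a)} {suc m} (s≤s (s≤s a<m*2)) = s≤s (s≤s (flipLowBit-<-*2 {a} {m} a<m*2))

flipLowBit-< : ∀ f {a} → a < 2 ^ suc f → flipLowBit a < 2 ^ suc f
flipLowBit-< f {a} a< =
  subst (flipLowBit a <_) (*-comm (2 ^ f) 2) (flipLowBit-<-*2 {a} {2 ^ f} (subst (a <_) (*-comm 2 (2 ^ f)) a<))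

n<2^n : ∀ n → n < 2 ^ n
n<2^n zero    = s≤s z≤n
n<2^n (suc n) = +-mono-≤ (m^n>0 2 n) (subst (suc n ≤_) (sym (+-identityʳ (2 ^ n))) (n<2^n n))

⌊log₂⌋-< : ∀ n → 1 ≤ n → ⌊log₂ n ⌋ < n
⌊log₂⌋-< (suc n) _ = s≤s (≤-trans (⌊log₂⌋-mono-≤ (n<2^n n)) (≤-reflexive (⌊log₂[2^n]⌋≡n n)))

private
  <2*suc⌊/2⌋ : ∀ n → n < 2 * suc ⌊ n /2⌋
  <2*suc⌊/2⌋ zero          = s≤s z≤n
  <2*suc⌊/2⌋ (suc zero)    = s≤s (s≤s z≤n)
  <2*suc⌊/2⌋ (suc (suc n)) = subst (2 + n <_) (sym (*-suc 2 (suc ⌊ n /2⌋))) (s≤s (s≤s (<2*suc⌊/2⌋ n)))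

  ⌊log₂⌋≡suc⌊log₂⌊/2⌋⌋ : ∀ n → 2 ≤ n → ⌊log₂ n ⌋ ≡ suc ⌊log₂ ⌊ n /2⌋ ⌋
  ⌊log₂⌋≡suc⌊log₂⌊/2⌋⌋ n 2≤n = begin
    ⌊log₂ n ⌋              ≡⟨ m∸n+n≡m 1≤⌊log₂n⌋ ⟨
    ⌊log₂ n ⌋ ∸ 1 + 1      ≡⟨ +-comm _ 1 ⟩
    suc (⌊log₂ n ⌋ ∸ 1)    ≡⟨ cong suc (⌊log₂⌊n/2⌋⌋≡⌊log₂n⌋∸1 n) ⟨
    suc ⌊log₂ ⌊ n /2⌋ ⌋    ∎
    where
    open ≡-Reasoning
    1≤⌊log₂n⌋ : 1 ≤ ⌊log₂ n ⌋
    1≤⌊log₂n⌋ = ≤-trans (≤-reflexive (sym (⌊log₂[2^n]⌋≡n 1))) (⌊log₂⌋-mono-≤ 2≤n)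

<2^suc⌊log₂⌋ : ∀ n → n < 2 ^ suc ⌊log₂ n ⌋
<2^suc⌊log₂⌋ = <-rec (λ n → n < 2 ^ suc ⌊log₂ n ⌋) bound
  where
  open ≤-Reasoning
  bound : ∀ n → (∀ {m} → m < n → m < 2 ^ suc ⌊log₂ m ⌋) → n < 2 ^ suc ⌊log₂ n ⌋
  bound zero          _   = s≤s z≤n
  bound (suc zero)    _   = s≤s (s≤s z≤n)
  bound n@(suc (suc k)) rec = begin-strict
    n                            <⟨ <2*suc⌊/2⌋ n ⟩
    2 * suc ⌊ n /2⌋              ≤⟨ *-monoʳ-≤ 2 (rec (⌊n/2⌋<n (suc k))) ⟩
    2 * 2 ^ suc ⌊log₂ ⌊ n /2⌋ ⌋  ≡⟨ cong (λ e → 2 ^ suc e) (⌊log₂⌋≡suc⌊log₂⌊/2⌋⌋ n (s≤s (s≤s z≤n))) ⟨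
    2 ^ suc ⌊log₂ n ⌋            ∎

iterate-suc : ∀ {A : Set} (f : A → A) x j → iterate f x (suc j) ≡ f (iterate f x j)
iterate-suc f x j = trans (sym (iterate-is-fold x f (suc j))) (cong f (iterate-is-fold x f j))

iterate-⌊log₂⌋-logStarAux≤1 : ∀ f x → x ≤ f → iterate ⌊log₂_⌋ x (logStarAux f x) ≤ 1
iterate-⌊log₂⌋-logStarAux≤1 zero    x x≤0 = ≤-trans x≤0 z≤n
iterate-⌊log₂⌋-logStarAux≤1 (suc f) x x≤f with x ≤? 1
... | yes x≤1 = x≤1
... | no  x≰1 = iterate-⌊log₂⌋-logStarAux≤1 f ⌊log₂ x ⌋
                  (≤-pred (≤-trans (⌊log₂⌋-< x (≤-trans (s≤s z≤n) (≰⇒> x≰1))) x≤f))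

iterate-⌊log₂⌋-log*≤1 : ∀ x → iterate ⌊log₂_⌋ x (log* x) ≤ 1
iterate-⌊log₂⌋-log*≤1 x = iterate-⌊log₂⌋-logStarAux≤1 x x ≤-refl

private
  2*suc[3+m]≤2^[3+m] : ∀ m → 2 * suc (3 + m) ≤ 2 ^ (3 + m)
  2*suc[3+m]≤2^[3+m] zero    = ≤-refl
  2*suc[3+m]≤2^[3+m] (suc m) = *-monoʳ-≤ 2 (≤-trans suc[k]≤2*k (2*suc[3+m]≤2^[3+m] m))
    where
    k = 3 + m
    suc[k]≤2*k : suc (suc k) ≤ 2 * suc k
    suc[k]≤2*k = ≤-trans (s≤s (s≤s (m≤m+n k (k + 0)))) (≤-reflexive (sym (*-suc 2 k)))

  2^[1+k]≡2^k+2^k : ∀ k → 2 ^ suc k ≡ 2 ^ k + 2 ^ k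
  2^[1+k]≡2^k+2^k k = cong (2 ^ k +_) (+-identityʳ (2 ^ k))

-- One Cole–Vishkin round maps labels of d + y bits to labels of d + ⌊log₂ y⌋ bits.
2*[4+m+y]≤2^[4+m+⌊log₂y⌋] : ∀ m y → 2 * (4 + m + y) ≤ 2 ^ (4 + m + ⌊log₂ y ⌋)
2*[4+m+y]≤2^[4+m+⌊log₂y⌋] m y = begin
  2 * (4 + m + y)                    ≡⟨ *-distribˡ-+ 2 (4 + m) y ⟩
  2 * (4 + m) + 2 * y                ≤⟨ +-mono-≤ (≤-trans (2*suc[3+m]≤2^[3+m] m) (^-monoʳ-≤ 2 (m≤m+n (3 + m) ℓ)))
                                                 (<⇒≤ 2*y<2^[3+m+ℓ]) ⟩
  2 ^ (3 + m + ℓ) + 2 ^ (3 + m + ℓ)  ≡⟨ 2^[1+k]≡2^k+2^k (3 + m + ℓ) ⟨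
  2 ^ (4 + m + ℓ)                    ∎
  where
  open ≤-Reasoning
  ℓ = ⌊log₂ y ⌋
  2*y<2^[3+m+ℓ] : 2 * y < 2 ^ (3 + m + ℓ)
  2*y<2^[3+m+ℓ] = <-≤-trans (*-monoʳ-< 2 (<2^suc⌊log₂⌋ y))
                    (^-monoʳ-≤ 2 (s≤s (s≤s (≤-trans (m≤n+m ℓ (1 + m)) (≤-reflexive (+-assoc 1 m ℓ))))))

x^2≤2^[3+x] : ∀ x → x ^ 2 ≤ 2 ^ (3 + x)
x^2≤2^[3+x] zero    = z≤n
x^2≤2^[3+x] (suc x) = begin
  suc x ^ 2                    ≡⟨ square-suc x ⟩
  x ^ 2 + suc (2 * x)          ≤⟨ +-mono-≤ (x^2≤2^[3+x] x) 1+2x≤2^[3+x] ⟩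
  2 ^ (3 + x) + 2 ^ (3 + x)    ≡⟨ 2^[1+k]≡2^k+2^k (3 + x) ⟨
  2 ^ (3 + suc x)              ∎
  where
  open ≤-Reasoning
  square-suc : ∀ x → suc x * (suc x * 1) ≡ x * (x * 1) + suc (2 * x)
  square-suc = solve-∀
  1+2x≤2^[3+x] : suc (2 * x) ≤ 2 ^ (3 + x)
  1+2x≤2^[3+x] = begin
    suc (2 * x)     ≤⟨ n≤1+n _ ⟩
    2 + 2 * x       ≡⟨ *-suc 2 x ⟨
    2 * suc x       ≤⟨ *-monoʳ-≤ 2 (n<2^n x) ⟩
    2 ^ suc x       ≤⟨ ^-monoʳ-≤ 2 (m≤n+m (suc x) 2) ⟩
    2 ^ (3 + x)     ∎

C*x^2≤2^[4+C+x] : ∀ C x → C * x ^ 2 ≤ 2 ^ (4 + C + x)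
C*x^2≤2^[4+C+x] C x = begin
  C * x ^ 2            ≤⟨ *-mono-≤ (<⇒≤ (n<2^n C)) (x^2≤2^[3+x] x) ⟩
  2 ^ C * 2 ^ (3 + x)  ≡⟨ ^-distribˡ-+-* 2 C (3 + x) ⟨
  2 ^ (C + (3 + x))    ≡⟨ cong (2 ^_) (trans (+-comm C (3 + x)) (cong (3 +_) (+-comm x C))) ⟩
  2 ^ (3 + C + x)      ≤⟨ ^-monoʳ-≤ 2 (n≤1+n (3 + C + x)) ⟩
  2 ^ (4 + C + x)      ∎
  where open ≤-Reasoning

1+a+L≤[1+a]*L+1+a : ∀ a L → suc (a + L) ≤ suc a * L + suc a
1+a+L≤[1+a]*L+1+a a L = begin
  suc a + L          ≡⟨ +-comm (suc a) L ⟩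
  L + suc a          ≤⟨ +-monoˡ-≤ (suc a) (m≤m+n L (a * L)) ⟩
  suc a * L + suc a  ∎
  where open ≤-Reasoning

-- The algorithm

-- label is the Cole–Vishkin label; transversal marks the nodes outside the independent set.
record NodeState : Set where
  field
    rank clock colour label : ℕ
    transversal candidate   : Bool
open NodeState

data Stage : Set where
  initialise : Stage
  reduce     : ℕ → Stage
  nominate   : ℕ → Stage
  prune      : ℕ → Stage

nextColour : Stage → Stage
nextColour (nominate i) = nominate (suc i)
nextColour (prune i)    = prune (suc i)
nextColour a            = a

sweep : ℕ → Stage
sweep zero          = nominate 0
sweep (suc zero)    = prune 0
sweep (suc (suc k)) = nextColour (sweep k)

schedule : ℕ → ℕ → Stage
schedule L zero = initialise
schedule L (suc t) with t <? L
... | yes _ = reduce t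
... | no  _ = sweep (t ∸ L)

-- In the functions below g lists the states of the other members of one hyperedge of s.
minColour : NodeState → List NodeState → ℕ
minColour s g = min (suc (colour s)) (map colour g)

heads : NodeState → List NodeState → Bool
heads s g = colour s <ᵇ minColour s g

-- The maximum makes this independent of the order of g; in a properly coloured hyperedge at most
-- one member has colour c.
labelOfColour : ℕ → List NodeState → ℕ
labelOfColour c g = max 0 (map (λ u → if colour u ≡ᵇ c then label u else 0) g)

parentLabel : NodeState → List (List NodeState) → ℕ
parentLabel s xs =
  if any (λ g → not (heads s g)) xs
  then max 0 (map (λ g → if heads s g then 0 else labelOfColour (minColour s g) g) xs)
  else flipLowBit (label s)

keeper : NodeState → Bool
keeper u = transversal u ∧ not (candidate u)

smallerCandidate : NodeState → NodeState → Bool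
smallerCandidate s u = candidate u ∧ (colour u <ᵇ colour s)

mayLeave : NodeState → List NodeState → Bool
mayLeave s g = heads s g ∨ (any keeper g ∨ any (smallerCandidate s) g)

sweepStart : ℕ → ℕ → ℕ
sweepStart L i = suc (i * 2 + L)

module Algorithm (C : ℕ) where

  bits : ℕ → ℕ → ℕ
  bits r j = 4 + C + iterate ⌊log₂_⌋ (2 * r) j

  stage : NodeState → Stage
  stage s = schedule (log* (2 * rank s)) (clock s)

  label′ : Stage → NodeState → List (List NodeState) → ℕ
  label′ (reduce j) s xs = cvLabel (bits (rank s) j) (label s) (parentLabel s xs)
  label′ _          s xs = label s

  transversal′ : Stage → NodeState → List (List NodeState) → Bool
  transversal′ initialise s xs = any (heads s) xs
  transversal′ (prune _)  s xs = transversal s ∧ not (candidate s ∧ all (mayLeave s) xs)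
  transversal′ _          s xs = transversal s

  candidate′ : Stage → NodeState → List (List NodeState) → Bool
  candidate′ (nominate i) s xs = transversal s ∧ ((label s ≡ᵇ i) ∧ all (any transversal) xs)
  candidate′ _            s xs = candidate s

  transitionAt : Stage → NodeState → List (List NodeState) → NodeState
  transitionAt a s xs = record
    { rank        = rank s
    ; clock       = suc (clock s)
    ; colour      = colour s
    ; label       = label′ a s xs
    ; transversal = transversal′ a s xs
    ; candidate   = candidate′ a s xs
    }

  transition : NodeState → List (List NodeState) → NodeState
  transition s = transitionAt (stage s) s

  palette : ℕ
  palette = 2 ^ (5 + C)

  private
    any-↭ : (p : NodeState → Bool) → ∀ {g g′} → g ↭ g′ → any p g ≡ any p g′
    any-↭ p q = foldr-↭ _∨_ ∨-comm ∨-assoc false (map⁺ p q)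

    minColour-↭ : ∀ s {g g′} → g ↭ g′ → minColour s g ≡ minColour s g′
    minColour-↭ s q = min-↭ _ (map⁺ colour q)

    heads-↭ : ∀ s {g g′} → g ↭ g′ → heads s g ≡ heads s g′
    heads-↭ s q = cong (colour s <ᵇ_) (minColour-↭ s q)

    labelOfColour-↭ : ∀ c {g g′} → g ↭ g′ → labelOfColour c g ≡ labelOfColour c g′
    labelOfColour-↭ c q = max-↭ 0 (map⁺ _ q)

    parentLabelIn-↭ : ∀ s {g g′} → g ↭ g′ → labelOfColour (minColour s g) g ≡ labelOfColour (minColour s g′) g′
    parentLabelIn-↭ s {g} q = trans (cong (λ c → labelOfColour c g) (minColour-↭ s q)) (labelOfColour-↭ _ q)

    mayLeave-↭ : ∀ s {g g′} → g ↭ g′ → mayLeave s g ≡ mayLeave s g′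
    mayLeave-↭ s q = cong₂ _∨_ (heads-↭ s q) (cong₂ _∨_ (any-↭ keeper q) (any-↭ (smallerCandidate s) q))

    parentLabel-≈ₘ : ∀ s {xs ys} → xs ≈ₘ ys → parentLabel s xs ≡ parentLabel s ys
    parentLabel-≈ₘ s q = cong₂ (λ b m → if b then m else flipLowBit (label s))
      (any-≈ₘ _ (λ p → cong not (heads-↭ s p)) q)
      (max-≈ₘ _ (λ p → cong₂ (λ h m → if h then 0 else m) (heads-↭ s p) (parentLabelIn-↭ s p)) q)

    label′-≈ₘ : ∀ a s {xs ys} → xs ≈ₘ ys → label′ a s xs ≡ label′ a s ys
    label′-≈ₘ initialise   s q = refl
    label′-≈ₘ (reduce j)   s q = cong (cvLabel _ (label s)) (parentLabel-≈ₘ s q)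
    label′-≈ₘ (nominate i) s q = refl
    label′-≈ₘ (prune i)    s q = refl

    transversal′-≈ₘ : ∀ a s {xs ys} → xs ≈ₘ ys → transversal′ a s xs ≡ transversal′ a s ys
    transversal′-≈ₘ initialise   s q = any-≈ₘ (heads s) (heads-↭ s) q
    transversal′-≈ₘ (reduce j)   s q = refl
    transversal′-≈ₘ (nominate i) s q = refl
    transversal′-≈ₘ (prune i)    s q =
      cong (λ b → transversal s ∧ not (candidate s ∧ b)) (all-≈ₘ (mayLeave s) (mayLeave-↭ s) q)

    candidate′-≈ₘ : ∀ a s {xs ys} → xs ≈ₘ ys → candidate′ a s xs ≡ candidate′ a s ys
    candidate′-≈ₘ initialise   s q = refl
    candidate′-≈ₘ (reduce j)   s q = refl
    candidate′-≈ₘ (nominate i) s q =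
      cong (λ b → transversal s ∧ ((label s ≡ᵇ i) ∧ b)) (all-≈ₘ (any transversal) (any-↭ transversal) q)
    candidate′-≈ₘ (prune i)    s q = refl

    cong₃ : ∀ {A B D E : Set} (f : A → B → D → E) {a a′ b b′ d d′} →
            a ≡ a′ → b ≡ b′ → d ≡ d′ → f a b d ≡ f a′ b′ d′
    cong₃ f refl refl refl = refl

  transitionAt-≈ₘ : ∀ a s {xs ys} → xs ≈ₘ ys → transitionAt a s xs ≡ transitionAt a s ys
  transitionAt-≈ₘ a s {xs} q = cong₃ (λ l t c → record (transitionAt a s xs) { label = l ; transversal = t ; candidate = c })
    (label′-≈ₘ a s q) (transversal′-≈ₘ a s q) (candidate′-≈ₘ a s q)

  algorithm : LocalAlg
  algorithm = record
    { State    = NodeState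
    ; init     = λ n Δ r ident c deg → record
                   { rank = r ; clock = 0 ; colour = c ; label = c ; transversal = false ; candidate = false }
    ; step     = transition
    ; step-inv = λ s xs ys → transitionAt-≈ₘ (stage s) s
    ; rounds   = λ n Δ r → sweepStart (log* (2 * r)) palette
    ; output   = λ s → not (transversal s)
    }

sweep-nominate : ∀ i → sweep (i * 2) ≡ nominate i
sweep-nominate zero    = refl
sweep-nominate (suc i) = cong nextColour (sweep-nominate i)

sweep-prune : ∀ i → sweep (suc (i * 2)) ≡ prune i
sweep-prune zero    = refl
sweep-prune (suc i) = cong nextColour (sweep-prune i)

schedule-reduce : ∀ {L j} → j < L → schedule L (suc j) ≡ reduce j
schedule-reduce {L} {j} j<L with j <? L
... | yes _   = refl
... | no  j≮L = ⊥-elim (j≮L j<L)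

schedule-sweep : ∀ L k → schedule L (suc (k + L)) ≡ sweep k
schedule-sweep L k with k + L <? L
... | yes k+L<L = ⊥-elim (<⇒≱ k+L<L (m≤n+m L k))
... | no  _     = cong sweep (m+n∸n≡m k L)

schedule-nominate : ∀ L i → schedule L (sweepStart L i) ≡ nominate i
schedule-nominate L i = trans (schedule-sweep L (i * 2)) (sweep-nominate i)

schedule-prune : ∀ L i → schedule L (suc (sweepStart L i)) ≡ prune i
schedule-prune L i = trans (schedule-sweep L (suc (i * 2))) (sweep-prune i)

module Correctness (C : ℕ) {n : ℕ} (H : Hypergraph n) (r : ℕ) (ident col : Fin n → ℕ)
                   (degree≤2 : ∀ v → degree H v ≤ 2) (proper : ProperColoring H col)
                   (col-bounded : ∀ v → col v < C * (2 * r) ^ 2) where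

  open Algorithm C

  L : ℕ
  L = log* (2 * r)

  state : ℕ → Fin n → NodeState
  state = run algorithm H 2 r ident col

  co-members : Subset n → Fin n → List (Fin n)
  co-members = others algorithm H 2 r ident col

  group : ℕ → Fin n → Subset n → List NodeState
  group t v e = map (state t) (co-members e v)

  groups : ℕ → Fin n → List (List NodeState)
  groups t v = map (group t v) (incident H v)

  ∈-members⁺ : ∀ {e u} → u ∈ e → u ∈ₗ members algorithm H 2 r ident col e
  ∈-members⁺ {e} {u} u∈e = ∈-filter⁺ (_∈? e) (∈-allFin u) u∈e

  ∈-members⁻ : ∀ {e u} → u ∈ₗ members algorithm H 2 r ident col e → u ∈ e
  ∈-members⁻ {e} m = proj₂ (∈-filter⁻ (_∈? e) {xs = allFin n} m)

  ∈-co-members⁺ : ∀ {e v u} → u ∈ e → u ≢ v → u ∈ₗ co-members e v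
  ∈-co-members⁺ {e} {v} u∈e u≢v = ∈-filter⁺ (λ w → ¬? (w ≟ᶠ v)) (∈-members⁺ u∈e) u≢v

  ∈-co-members⁻ : ∀ {e v u} → u ∈ₗ co-members e v → u ∈ e × u ≢ v
  ∈-co-members⁻ {e} {v} m =
    let m′ , u≢v = ∈-filter⁻ (λ w → ¬? (w ≟ᶠ v)) {xs = members algorithm H 2 r ident col e} m
    in ∈-members⁻ m′ , u≢v

  ∈-incident⁺ : ∀ {v e} → e ∈ₗ edges H → v ∈ e → e ∈ₗ incident H v
  ∈-incident⁺ {v} e∈E v∈e = ∈-filter⁺ (v ∈?_) e∈E v∈e

  ∈-incident⁻ : ∀ {v e} → e ∈ₗ incident H v → e ∈ₗ edges H × v ∈ e
  ∈-incident⁻ {v} m = ∈-filter⁻ (v ∈?_) {xs = edges H} m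

  Heads : Fin n → Subset n → Set
  Heads v e = ∀ {u} → u ∈ e → u ≢ v → col v < col u

  headsᵇ : Fin n → Subset n → Bool
  headsᵇ v e = col v <ᵇ min (suc (col v)) (map col (co-members e v))

  T-headsᵇ⁻ : ∀ {v e} → T (headsᵇ v e) → Heads v e
  T-headsᵇ⁻ {v} {e} t u∈e u≢v =
    <-≤-trans (<ᵇ⇒< _ _ t) (All.lookup (min≤xs _ _) (∈-map⁺ col (∈-co-members⁺ u∈e u≢v)))

  T-headsᵇ⁺ : ∀ {v e} → Heads v e → T (headsᵇ v e)
  T-headsᵇ⁺ {v} {e} hd = <⇒<ᵇ (v<min⁺ (n<1+n (col v)) (Allₚ.map⁺ (All.tabulate λ m →
    let u∈e , u≢v = ∈-co-members⁻ m in hd u∈e u≢v)))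

  head-exists : ∀ {e} → e ∈ₗ edges H → ∃ λ h → h ∈ e × Heads h e
  head-exists {e} e∈E = h , h∈e , λ {w} w∈e w≢h →
      ≤∧≢⇒< (All.lookup (f[argmin]≤f[xs] u ms) (∈-members⁺ w∈e))
            (proper e e∈E h w h∈e w∈e (λ h≡w → w≢h (sym h≡w)))
    where
    u   = proj₁ (All.lookup (nonempty H) e∈E)
    ms  = members algorithm H 2 r ident col e
    h   = argmin col u ms
    h∈e : h ∈ e
    h∈e with argmin-sel col u ms
    ... | inj₁ h≡u = subst (_∈ e) (sym h≡u) (proj₂ (All.lookup (nonempty H) e∈E))
    ... | inj₂ h∈ms = ∈-members⁻ h∈ms

  heads-asym : ∀ {e h x} → h ∈ e → x ∈ e → x ≢ h → Heads h e → ¬ Heads x e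
  heads-asym h∈e x∈e x≢h h-heads x-heads = <-asym (h-heads x∈e x≢h) (x-heads h∈e (λ h≡x → x≢h (sym h≡x)))

  Leader : Fin n → Set
  Leader v = ∃ λ e → e ∈ₗ incident H v × Heads v e

  leaderᵇ : Fin n → Bool
  leaderᵇ v = any (headsᵇ v) (incident H v)

  T-leaderᵇ⁻ : ∀ {v} → T (leaderᵇ v) → Leader v
  T-leaderᵇ⁻ {v} t = let e , e∈ , h = find (any⁻ (headsᵇ v) (incident H v) t) in e , e∈ , T-headsᵇ⁻ h

  T-leaderᵇ⁺ : ∀ {v} → Leader v → T (leaderᵇ v)
  T-leaderᵇ⁺ {v} (e , e∈ , hd) = any⁺ (headsᵇ v) (lose e∈ (T-headsᵇ⁺ hd))

  head-leader : ∀ {e h} → e ∈ₗ edges H → h ∈ e → Heads h e → Leader h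
  head-leader e∈E h∈e hd = _ , ∈-incident⁺ e∈E h∈e , hd

  -- A leader has at most two hyperedges and heads one of them.
  non-headed-unique : ∀ {v e e′} → Leader v → e ∈ₗ incident H v → e′ ∈ₗ incident H v →
                      ¬ Heads v e → ¬ Heads v e′ → e ≡ e′
  non-headed-unique {v} {e} {e′} (a , a∈ , a-headed) e∈ e′∈ ¬e ¬e′ with ≡-dec Bool._≟_ e e′
  ... | yes e≡e′ = e≡e′
  ... | no  e≢e′ = ⊥-elim (<⇒≱ (s≤s (degree≤2 v))
        (distinct⇒3≤length (incident H v) a∈ e∈ e′∈ (λ { refl → ¬e a-headed }) (λ { refl → ¬e′ a-headed }) e≢e′))

  ParentOf : Fin n → Fin n → Set
  ParentOf x h = ∃ λ b → b ∈ₗ incident H x × ¬ Heads x b × h ∈ b × Heads h b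

  root-or-child : ∀ v → (∀ {e} → e ∈ₗ incident H v → Heads v e) ⊎ ∃ λ b → b ∈ₗ incident H v × ¬ Heads v b
  root-or-child v with any? (λ e → ¬? (T? (headsᵇ v e))) (incident H v)
  ... | yes some = let b , b∈ , ¬t = find some in inj₂ (b , b∈ , λ hd → ¬t (T-headsᵇ⁺ hd))
  ... | no  none = inj₁ λ e∈ → T-headsᵇ⁻ (decidable-stable (T? _) (λ ¬t → none (lose e∈ ¬t)))

  parent-exists : ∀ {x b} → b ∈ₗ incident H x → ¬ Heads x b → ∃ λ h → ParentOf x h
  parent-exists b∈ ¬hd = let h , h∈b , hd = head-exists (proj₁ (∈-incident⁻ b∈)) in h , _ , b∈ , ¬hd , h∈b , hd

  parent-leader : ∀ {x h} → ParentOf x h → Leader h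
  parent-leader (b , b∈ , _ , h∈b , hd) = head-leader (proj₁ (∈-incident⁻ b∈)) h∈b hd

  parent-≢ : ∀ {x h} → ParentOf x h → x ≢ h
  parent-≢ (b , b∈ , ¬hd , h∈b , hd) refl = ¬hd hd

  rank-state : ∀ t v → rank (state t v) ≡ r
  rank-state zero    v = refl
  rank-state (suc t) v = rank-state t v

  clock-state : ∀ t v → clock (state t v) ≡ t
  clock-state zero    v = refl
  clock-state (suc t) v = cong suc (clock-state t v)

  colour-state : ∀ t v → colour (state t v) ≡ col v
  colour-state zero    v = refl
  colour-state (suc t) v = colour-state t v

  state-suc : ∀ t {a} → schedule L t ≡ a → ∀ v → state (suc t) v ≡ transitionAt a (state t v) (groups t v)
  state-suc t eq v = cong (λ a → transitionAt a (state t v) (groups t v))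
    (trans (cong₂ (λ ρ c → schedule (log* (2 * ρ)) c) (rank-state t v) (clock-state t v)) eq)

  private
    colours-state : ∀ t us → map colour (map (state t) us) ≡ map col us
    colours-state t us = trans (sym (map-∘ us)) (map-cong (colour-state t) us)

    map-groups : ∀ {A : Set} (F : List NodeState → A) t v → map F (groups t v) ≡ map (λ e → F (group t v e)) (incident H v)
    map-groups F t v = sym (map-∘ (incident H v))

  heads-state : ∀ t v e → heads (state t v) (group t v e) ≡ headsᵇ v e
  heads-state t v e = cong₂ (λ c cs → c <ᵇ min (suc c) cs) (colour-state t v) (colours-state t (co-members e v))

  any-groups : ∀ (F : List NodeState → Bool) t v → any F (groups t v) ≡ any (λ e → F (group t v e)) (incident H v)
  any-groups F t v = cong or (map-groups F t v)

  all-groups : ∀ (F : List NodeState → Bool) t v → all F (groups t v) ≡ all (λ e → F (group t v e)) (incident H v)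
  all-groups F t v = cong and (map-groups F t v)

  transversal-state₁ : ∀ v → transversal (state 1 v) ≡ leaderᵇ v
  transversal-state₁ v = trans (any-groups (heads (state 0 v)) 0 v) (cong or (map-cong (heads-state 0 v) (incident H v)))

  minColour-state : ∀ t {x b h} → x ∈ b → h ∈ b → Heads h b → x ≢ h → minColour (state t x) (group t x b) ≡ col h
  minColour-state t {x} {b} {h} x∈b h∈b hd x≢h =
    trans (cong₂ (λ c cs → min (suc c) cs) (colour-state t x) (colours-state t (co-members b x)))
          (min-map≡ col (∈-co-members⁺ h∈b (λ h≡x → x≢h (sym h≡x))) least (≤-trans (<⇒≤ (hd x∈b x≢h)) (n≤1+n _)))
    where
    least : ∀ {u} → u ∈ₗ co-members b x → col h ≤ col u
    least {u} m with u ≟ᶠ h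
    ... | yes refl = ≤-refl
    ... | no  u≢h  = <⇒≤ (hd (proj₁ (∈-co-members⁻ m)) u≢h)

  labelOfColour-state : ∀ t {x b h} → b ∈ₗ edges H → h ∈ b → x ≢ h → labelOfColour (col h) (group t x b) ≡ label (state t h)
  labelOfColour-state t {x} {b} {h} b∈E h∈b x≢h =
    trans (cong (max 0) (sym (map-∘ (co-members b x))))
          (max-map≡ picked (∈-co-members⁺ h∈b (λ h≡x → x≢h (sym h≡x))) picked-h picked-≤)
    where
    picked : Fin n → ℕ
    picked u = if colour (state t u) ≡ᵇ col h then label (state t u) else 0
    picked-h : picked h ≡ label (state t h)
    picked-h = if-T (≡⇒≡ᵇ _ _ (colour-state t h))
    picked-≤ : ∀ {u} → u ∈ₗ co-members b x → picked u ≤ label (state t h)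
    picked-≤ {u} m with u ≟ᶠ h
    ... | yes refl = ≤-reflexive picked-h
    ... | no  u≢h  = ≤-trans (≤-reflexive (if-¬T λ same → proper b b∈E u h (proj₁ (∈-co-members⁻ m)) h∈b u≢h
                                                     (trans (sym (colour-state t u)) (≡ᵇ⇒≡ _ _ same)))) z≤n

  parent-label : ℕ → Fin n → ℕ
  parent-label t v = parentLabel (state t v) (groups t v)

  parent-label-child : ∀ t {x h} → Leader x → ParentOf x h → parent-label t x ≡ label (state t h)
  parent-label-child t {x} {h} ldr par@(b , b∈ , ¬hd , h∈b , hd) = begin
    parent-label t x                                    ≡⟨ if-T some-non-headed ⟩
    max 0 (map F (groups t x))                          ≡⟨ cong (max 0) (map-groups F t x) ⟩
    max 0 (map (λ e → F (group t x e)) (incident H x))  ≡⟨ max-map≡ _ b∈ F-b F-≤ ⟩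
    label (state t h)                                   ∎
    where
    open ≡-Reasoning
    b∈E = proj₁ (∈-incident⁻ b∈)
    x∈b = proj₂ (∈-incident⁻ b∈)
    F : List NodeState → ℕ
    F g = if heads (state t x) g then 0 else labelOfColour (minColour (state t x) g) g
    ¬heads : ∀ {e} → ¬ Heads x e → ¬ T (heads (state t x) (group t x e))
    ¬heads ¬hd′ headed = ¬hd′ (T-headsᵇ⁻ (subst T (heads-state t x _) headed))
    some-non-headed : T (any (λ g → not (heads (state t x) g)) (groups t x))
    some-non-headed = subst T (sym (any-groups _ t x)) (any⁺ _ (lose b∈ (T-not⁺ (¬heads ¬hd))))
    F-b : F (group t x b) ≡ label (state t h)
    F-b = begin
      F (group t x b)                                          ≡⟨ if-¬T (¬heads ¬hd) ⟩
      labelOfColour (minColour (state t x) (group t x b)) (group t x b)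
                                                               ≡⟨ cong (λ c → labelOfColour c (group t x b))
                                                                       (minColour-state t x∈b h∈b hd (parent-≢ par)) ⟩
      labelOfColour (col h) (group t x b)                      ≡⟨ labelOfColour-state t b∈E h∈b (parent-≢ par) ⟩
      label (state t h)                                        ∎
    F-≤ : ∀ {e} → e ∈ₗ incident H x → F (group t x e) ≤ label (state t h)
    F-≤ {e} e∈ with T? (headsᵇ x e)
    ... | yes headed = ≤-trans (≤-reflexive (if-T (subst T (sym (heads-state t x e)) headed))) z≤n
    ... | no ¬t with non-headed-unique ldr e∈ b∈ (λ hd′ → ¬t (T-headsᵇ⁺ hd′)) ¬hd
    ...   | refl = ≤-reflexive F-b

  parent-label-root : ∀ t {x} → (∀ {e} → e ∈ₗ incident H x → Heads x e) →
                     parent-label t x ≡ flipLowBit (label (state t x))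
  parent-label-root t {x} all-headed = if-¬T λ some →
    let e , e∈ , ¬headed = find (any⁻ _ _ (subst T (any-groups _ t x) some))
    in T-not⁻ ¬headed (subst T (sym (heads-state t x e)) (T-headsᵇ⁺ (all-headed e∈)))

  -- Colour reduction on the forest of leaders

  reducing : ∀ {j} → j < L → ∀ v → state (suc (suc j)) v ≡ transitionAt (reduce j) (state (suc j) v) (groups (suc j) v)
  reducing {j} j<L = state-suc (suc j) (schedule-reduce j<L)

  flags-reducing : ∀ j → j ≤ L → ∀ v → transversal (state (suc j) v) ≡ leaderᵇ v × candidate (state (suc j) v) ≡ false
  flags-reducing zero    _   v = transversal-state₁ v , refl
  flags-reducing (suc j) j<L v =
    let tr , cd = flags-reducing j (<⇒≤ j<L) v
    in trans (cong transversal (reducing j<L v)) tr , trans (cong candidate (reducing j<L v)) cd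

  label-reducing : ∀ {j} → j < L → ∀ v →
                   label (state (suc (suc j)) v) ≡ cvLabel (bits r j) (label (state (suc j) v)) (parent-label (suc j) v)
  label-reducing {j} j<L v =
    trans (cong label (reducing j<L v))
          (cong (λ ρ → cvLabel (bits ρ j) (label (state (suc j) v)) (parent-label (suc j) v)) (rank-state (suc j) v))

  bits-step : ∀ j → 2 * bits r j ≤ 2 ^ bits r (suc j)
  bits-step j = subst (λ y → 2 * bits r j ≤ 2 ^ (4 + C + y)) (sym (iterate-suc ⌊log₂_⌋ (2 * r) j))
                      (2*[4+m+y]≤2^[4+m+⌊log₂y⌋] C (iterate ⌊log₂_⌋ (2 * r) j))

  record ProperLabels (t f : ℕ) : Set where
    field
      label-<        : ∀ {v} → Leader v → label (state t v) < 2 ^ f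
      label-≢-parent : ∀ {x h} → Leader x → ParentOf x h → label (state t x) ≢ label (state t h)
  open ProperLabels

  parent-label-proper : ∀ {t f} → ProperLabels t (suc f) → ∀ {v} → Leader v →
                       parent-label t v < 2 ^ suc f × label (state t v) ≢ parent-label t v
  parent-label-proper {t} {f} P {v} ldr with root-or-child v
  ... | inj₁ all-headed rewrite parent-label-root t all-headed = flipLowBit-< f (label-< P ldr) , flipLowBit-≢ _
  ... | inj₂ (b , b∈ , ¬hd) with parent-exists b∈ ¬hd
  ...   | h , par rewrite parent-label-child t ldr par = label-< P (parent-leader par) , label-≢-parent P ldr par

  labels-initial : ProperLabels 1 (bits r 0)
  labels-initial = record
    { label-<        = λ {v} _ → <-≤-trans (col-bounded v) (C*x^2≤2^[4+C+x] C (2 * r))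
    ; label-≢-parent = λ { {x} {h} _ par@(b , b∈ , _ , h∈b , _) →
        proper b (proj₁ (∈-incident⁻ b∈)) x h (proj₂ (∈-incident⁻ b∈)) h∈b (parent-≢ par) }
    }

  labels-reduce : ∀ {j} → j < L → ProperLabels (suc j) (bits r j) → ProperLabels (suc (suc j)) (bits r (suc j))
  labels-reduce {j} j<L P = record
    { label-<        = λ {v} ldr →
        let p< , ℓ≢p = parent-label-proper P ldr
        in subst (_< 2 ^ bits r (suc j)) (sym (label-reducing j<L v))
                 (<-≤-trans (cvLabel-< (bits r j) (label-< P ldr) p< ℓ≢p) (bits-step j))
    ; label-≢-parent = λ {x} {h} ldr par →
        let h-ldr = parent-leader par
            p< , ℓ≢p = parent-label-proper P h-ldr
            ℓ-parent : parent-label (suc j) x ≡ label (state (suc j) h)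
            ℓ-parent = parent-label-child (suc j) ldr par
        in λ eq → cvLabel-≢ (bits r j) (label-< P ldr) (label-< P h-ldr) p< (label-≢-parent P ldr par) ℓ≢p
                    (trans (cong (cvLabel (bits r j) (label (state (suc j) x))) (sym ℓ-parent))
                           (trans (sym (label-reducing j<L x)) (trans eq (label-reducing j<L h))))
    }

  labels-reduced : ∀ j → j ≤ L → ProperLabels (suc j) (bits r j)
  labels-reduced zero    _   = labels-initial
  labels-reduced (suc j) j<L = labels-reduce j<L (labels-reduced j (<⇒≤ j<L))

  finalLabel : Fin n → ℕ
  finalLabel v = label (state (suc L) v)

  finalLabel-< : ∀ {v} → Leader v → finalLabel v < palette
  finalLabel-< ldr = <-≤-trans (label-< (labels-reduced L ≤-refl) ldr) (^-monoʳ-≤ 2 bits≤)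
    where
    bits≤ : bits r L ≤ 5 + C
    bits≤ = ≤-trans (+-monoʳ-≤ (4 + C) (iterate-⌊log₂⌋-log*≤1 (2 * r))) (≤-reflexive (cong (4 +_) (+-comm C 1)))

  finalLabel-≢-parent : ∀ {x h} → Leader x → ParentOf x h → finalLabel x ≢ finalLabel h
  finalLabel-≢-parent = label-≢-parent (labels-reduced L ≤-refl)

  -- Pruning the transversal one label class at a time

  In : ℕ → Fin n → Set
  In t v = T (transversal (state t v))

  PrivateEdge : ℕ → Fin n → Set
  PrivateEdge t x = ∃ λ e → e ∈ₗ edges H × x ∈ e × (∀ {y} → y ∈ e → In t y → y ≡ x)

  Covers : ℕ → Set
  Covers t = ∀ {e} → e ∈ₗ edges H → ∃ λ y → y ∈ e × In t y

  record SweepInvariant (i : ℕ) : Set where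
    field
      in⇒leader    : ∀ {v} → In (sweepStart L i) v → Leader v
      covers       : Covers (sweepStart L i)
      private-edge : ∀ {x} → In (sweepStart L i) x → finalLabel x < i → PrivateEdge (sweepStart L i) x
  open SweepInvariant

  any-group⁻ : ∀ (p : NodeState → Bool) {t x e} → T (any p (group t x e)) → ∃ λ u → u ∈ₗ co-members e x × T (p (state t u))
  any-group⁻ p {t} {x} {e} tp = find (Anyₚ.map⁻ (any⁻ p (group t x e) tp))

  any-group⁺ : ∀ (p : NodeState → Bool) {t x e u} → u ∈ₗ co-members e x → T (p (state t u)) → T (any p (group t x e))
  any-group⁺ p u∈ tp = any⁺ p (Anyₚ.map⁺ (lose u∈ tp))

  colour-<ᵇ⁻ : ∀ t {u x} → T (colour (state t u) <ᵇ colour (state t x)) → col u < col x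
  colour-<ᵇ⁻ t {u} {x} lt = subst₂ _<_ (colour-state t u) (colour-state t x) (<ᵇ⇒< _ _ lt)

  colour-<ᵇ⁺ : ∀ t {u x} → col u < col x → T (colour (state t u) <ᵇ colour (state t x))
  colour-<ᵇ⁺ t {u} {x} lt = <⇒<ᵇ (subst₂ _<_ (sym (colour-state t u)) (sym (colour-state t x)) lt)

  label-sweepStart : ∀ i v → label (state (sweepStart L i) v) ≡ finalLabel v
  label-sweepStart zero    v = refl
  label-sweepStart (suc i) v =
    trans (cong label (state-suc (suc (sweepStart L i)) (schedule-prune L i) v))
          (trans (cong label (state-suc (sweepStart L i) (schedule-nominate L i) v)) (label-sweepStart i v))

  module Phase (i : ℕ) where

    start end : ℕ
    start = sweepStart L i
    end   = suc (suc start)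

    nominated : Fin n → NodeState
    nominated = state (suc start)

    mayLeaveᵇ : Fin n → Subset n → Bool
    mayLeaveᵇ x e = mayLeave (nominated x) (group (suc start) x e)

    leavesᵇ : Fin n → Bool
    leavesᵇ v = candidate (nominated v) ∧ all (mayLeave (nominated v)) (groups (suc start) v)

    Candidate : Fin n → Set
    Candidate v = T (candidate (nominated v))

    Keeper : Fin n → Set
    Keeper u = In start u × ¬ Candidate u

    MayLeave : Fin n → Subset n → Set
    MayLeave x e = Heads x e ⊎ (∃ λ u → u ∈ₗ co-members e x × Keeper u)
                             ⊎ (∃ λ u → u ∈ₗ co-members e x × Candidate u × col u < col x)

    private
      nominating : ∀ v → nominated v ≡ transitionAt (nominate i) (state start v) (groups start v)
      nominating = state-suc start (schedule-nominate L i)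

      pruning : ∀ v → state end v ≡ transitionAt (prune i) (nominated v) (groups (suc start) v)
      pruning = state-suc (suc start) (schedule-prune L i)

      candidate-≡ : ∀ v → candidate (nominated v) ≡
                          transversal (state start v) ∧ ((label (state start v) ≡ᵇ i) ∧ all (any transversal) (groups start v))
      candidate-≡ v = cong candidate (nominating v)

      transversal-≡ : ∀ v → transversal (state end v) ≡ transversal (state start v) ∧ not (leavesᵇ v)
      transversal-≡ v = trans (cong transversal (pruning v)) (cong (_∧ not (leavesᵇ v)) (cong transversal (nominating v)))

    T-mayLeave⁻ : ∀ {x e} → T (mayLeaveᵇ x e) → MayLeave x e
    T-mayLeave⁻ {x} {e} t with Equivalence.to T-∨ t
    ... | inj₁ hd = inj₁ (T-headsᵇ⁻ (subst T (heads-state (suc start) x e) hd))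
    ... | inj₂ t′ with Equivalence.to T-∨ t′
    ...   | inj₁ k = let u , u∈ , tk = any-group⁻ keeper {suc start} {x} {e} k
                         tr , ¬c = Equivalence.to T-∧ tk
                     in inj₂ (inj₁ (u , u∈ , subst T (cong transversal (nominating u)) tr , T-not⁻ ¬c))
    ...   | inj₂ c = let u , u∈ , tc = any-group⁻ (smallerCandidate (nominated x)) {suc start} {x} {e} c
                         cand , lt = Equivalence.to T-∧ tc
                     in inj₂ (inj₂ (u , u∈ , cand , colour-<ᵇ⁻ (suc start) lt))

    T-mayLeave⁺ : ∀ {x e} → MayLeave x e → T (mayLeaveᵇ x e)
    T-mayLeave⁺ {x} {e} may = Equivalence.from (T-∨ {heads s g} {any keeper g ∨ any (smallerCandidate s) g}) (excuse may)
      where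
      s = nominated x
      g = group (suc start) x e
      excuse : MayLeave x e → T (heads s g) ⊎ T (any keeper g ∨ any (smallerCandidate s) g)
      excuse (inj₁ hd) = inj₁ (subst T (sym (heads-state (suc start) x e)) (T-headsᵇ⁺ hd))
      excuse (inj₂ (inj₁ (u , u∈ , in-u , ¬cand))) = inj₂ (Equivalence.from T-∨ (inj₁ keeps))
        where
        keeps = any-group⁺ keeper {suc start} {x} {e} u∈
                  (Equivalence.from T-∧ (subst T (sym (cong transversal (nominating u))) in-u , T-not⁺ ¬cand))
      excuse (inj₂ (inj₂ (u , u∈ , cand , cu<cx))) = inj₂ (Equivalence.from (T-∨ {any keeper g}) (inj₂ smaller))
        where
        smaller = any-group⁺ (smallerCandidate s) {suc start} {x} {e} u∈
                    (Equivalence.from T-∧ (cand , colour-<ᵇ⁺ (suc start) cu<cx))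

    candidate⁻ : ∀ {v} → Candidate v →
                 In start v × finalLabel v ≡ i × (∀ {e} → e ∈ₗ incident H v → ∃ λ u → u ∈ₗ co-members e v × In start u)
    candidate⁻ {v} cand =
      let in-v , rest = Equivalence.to T-∧ (subst T (candidate-≡ v) cand)
          lbl , neighbours = Equivalence.to T-∧ rest
      in in-v , trans (sym (label-sweepStart i v)) (≡ᵇ⇒≡ _ _ lbl)
              , λ {e} e∈ → any-group⁻ transversal {start} {v} {e} (All.lookup (all⁺ _ _ (subst T (all-groups _ start v) neighbours)) e∈)

    isolated-non-candidate : ∀ {v} → In start v → finalLabel v ≡ i → ¬ Candidate v →
                             ∃ λ e → e ∈ₗ incident H v × (∀ {u} → u ∈ₗ co-members e v → ¬ In start u)
    isolated-non-candidate {v} in-v lbl ¬cand =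
      let e , e∈ , ¬some = find (¬All⇒Any¬ (λ e → T? _) (incident H v) ¬all)
      in e , e∈ , λ u∈ in-u → ¬some (any-group⁺ transversal {start} {v} {e} u∈ in-u)
      where
      ¬all : ¬ All (λ e → T (any transversal (group start v e))) (incident H v)
      ¬all all-e = ¬cand (subst T (sym (candidate-≡ v)) (Equivalence.from T-∧ (in-v , Equivalence.from T-∧
        (≡⇒≡ᵇ _ _ (trans (label-sweepStart i v) lbl) , subst T (sym (all-groups _ start v)) (all⁻ _ all-e)))))

    in-before : ∀ {v} → In end v → In start v
    in-before {v} in′ = proj₁ (Equivalence.to T-∧ (subst T (transversal-≡ v) in′))

    stays : ∀ {v} → In start v → ¬ Candidate v → In end v
    stays {v} in-v ¬cand = subst T (sym (transversal-≡ v))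
      (Equivalence.from T-∧ (in-v , T-not⁺ (λ both → ¬cand (proj₁ (Equivalence.to T-∧ both)))))

    leaving : ∀ {v} → In start v → ¬ In end v → Candidate v × (∀ {e} → e ∈ₗ incident H v → MayLeave v e)
    leaving {v} in-v out with T? (leavesᵇ v)
    ... | yes both = let cand , may = Equivalence.to T-∧ both
                     in cand , λ e∈ → T-mayLeave⁻ (All.lookup (all⁺ _ _ (subst T (all-groups _ (suc start) v) may)) e∈)
    ... | no ¬both = ⊥-elim (out (subst T (sym (transversal-≡ v)) (Equivalence.from T-∧ (in-v , T-not⁺ ¬both))))

    leaves : ∀ {v} → Candidate v → (∀ {e} → e ∈ₗ incident H v → MayLeave v e) → ¬ In end v
    leaves {v} cand may in′ = T-not⁻ (proj₂ (Equivalence.to T-∧ (subst T (transversal-≡ v) in′)))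
      (Equivalence.from T-∧ (cand , subst T (sym (all-groups _ (suc start) v)) (all⁻ _ (All.tabulate (λ e∈ → T-mayLeave⁺ (may e∈))))))

    staying-candidate : ∀ {v} → In end v → Candidate v → ∃ λ e → e ∈ₗ incident H v × ¬ MayLeave v e
    staying-candidate {v} in′ cand =
      let e , e∈ , ¬may = find (¬All⇒Any¬ (λ e → T? _) (incident H v) ¬all)
      in e , e∈ , λ may → ¬may (T-mayLeave⁺ may)
      where
      ¬all : ¬ All (λ e → T (mayLeaveᵇ v e)) (incident H v)
      ¬all all-e = leaves cand (λ e∈ → T-mayLeave⁻ (All.lookup all-e e∈)) in′

    private
      shrink : ∀ {x} → PrivateEdge start x → PrivateEdge end x
      shrink (e , e∈E , x∈e , only-x) = e , e∈E , x∈e , λ y∈e in-y → only-x y∈e (in-before in-y)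

      isolated-private : ∀ {x} → (∃ λ e → e ∈ₗ incident H x × (∀ {u} → u ∈ₗ co-members e x → ¬ In start u)) →
                         PrivateEdge end x
      isolated-private {x} (e , e∈ , none) = e , proj₁ (∈-incident⁻ e∈) , proj₂ (∈-incident⁻ e∈) ,
        λ {y} y∈e in-y → decidable-stable (y ≟ᶠ x) λ y≢x → none (∈-co-members⁺ y∈e y≢x) (in-before in-y)

    module _ (I : SweepInvariant i) where

      -- z is a candidate, so e has another member u in the transversal; u is a child of z, so its
      -- label is not i and it stays.
      headed-cover : ∀ {e z} → e ∈ₗ edges H → z ∈ e → Heads z e → Candidate z → ∃ λ y → y ∈ e × In end y
      headed-cover {e} {z} e∈E z∈e hd cand =
        let _ , lbl , neighbours = candidate⁻ cand
            u , u∈ , in-u = neighbours (∈-incident⁺ e∈E z∈e)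
            u∈e , u≢z = ∈-co-members⁻ u∈
            par : ParentOf u z
            par = e , ∈-incident⁺ e∈E u∈e , heads-asym z∈e u∈e u≢z hd , z∈e , hd
        in u , u∈e , stays in-u λ cand-u →
             finalLabel-≢-parent (in⇒leader I in-u) par (trans (proj₁ (proj₂ (candidate⁻ cand-u))) (sym lbl))

      -- Induction on the colour of a member in the transversal: if it leaves, it was excused by
      -- itself as head, by a keeper, or by a candidate of smaller colour.
      cover-below : ∀ k {e} → e ∈ₗ edges H → ∀ {z} → z ∈ e → col z < k → In start z →
                    ∃ λ y → y ∈ e × In end y
      cover-below (suc k) e∈E {z} z∈e (s≤s cz≤k) in-z with T? (transversal (state end z))
      ... | yes stayed = z , z∈e , stayed
      ... | no  left with leaving in-z left
      ...   | cand , may with may (∈-incident⁺ e∈E z∈e)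
      ...     | inj₁ hd = headed-cover e∈E z∈e hd cand
      ...     | inj₂ (inj₁ (u , u∈ , in-u , ¬cand-u)) = u , proj₁ (∈-co-members⁻ u∈) , stays in-u ¬cand-u
      ...     | inj₂ (inj₂ (u , u∈ , cand-u , cu<cz)) =
                  cover-below k e∈E (proj₁ (∈-co-members⁻ u∈)) (<-≤-trans cu<cz cz≤k) (proj₁ (candidate⁻ cand-u))

      covers-next : Covers end
      covers-next e∈E = let z , z∈e , in-z = covers I e∈E in cover-below (suc (col z)) e∈E z∈e ≤-refl in-z

      -- e is the only hyperedge y does not head, and there x excuses y.
      excused-by-smaller : ∀ {x y e} → e ∈ₗ edges H → x ∈ e → y ∈ e → x ≢ y → In start y → Candidate x →
                           col x < col y → ∀ {e′} → e′ ∈ₗ incident H y → MayLeave y e′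
      excused-by-smaller {x} {y} {e} e∈E x∈e y∈e x≢y in-y cand cx<cy {e′} e′∈ with T? (headsᵇ y e′)
      ... | yes hd = inj₁ (T-headsᵇ⁻ hd)
      ... | no ¬hd with non-headed-unique (in⇒leader I in-y) e′∈ (∈-incident⁺ e∈E y∈e)
                          (λ hd → ¬hd (T-headsᵇ⁺ hd)) (λ hd → <-asym cx<cy (hd x∈e x≢y))
      ...   | refl = inj₂ (inj₂ (x , ∈-co-members⁺ x∈e x≢y , cand , cx<cy))

      -- Some hyperedge e does not excuse x. Any other member y of e still in the transversal was then
      -- a candidate of larger colour, hence excused everywhere, so it left.
      candidate-private : ∀ {x} → In end x → Candidate x → PrivateEdge end x
      candidate-private {x} in-x cand with staying-candidate in-x cand
      ... | e , e∈ , ¬may = e , e∈E , x∈e , λ {y} y∈e in-y → decidable-stable (y ≟ᶠ x) (other-leaves y∈e in-y)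
        where
        e∈E = proj₁ (∈-incident⁻ e∈)
        x∈e = proj₂ (∈-incident⁻ e∈)
        other-leaves : ∀ {y} → y ∈ e → In end y → ¬ y ≢ x
        other-leaves {y} y∈e in-y y≢x = leaves cand-y (excused-by-smaller e∈E x∈e y∈e x≢y in-y₀ cand cx<cy) in-y
          where
          x≢y : x ≢ y
          x≢y x≡y = y≢x (sym x≡y)
          y∈ = ∈-co-members⁺ y∈e y≢x
          in-y₀ = in-before in-y
          cand-y : Candidate y
          cand-y = decidable-stable (T? _) λ ¬cand-y → ¬may (inj₂ (inj₁ (y , y∈ , in-y₀ , ¬cand-y)))
          cx<cy : col x < col y
          cx<cy = ≤∧≢⇒< (≮⇒≥ λ cy<cx → ¬may (inj₂ (inj₂ (y , y∈ , cand-y , cy<cx))))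
                        (proper e e∈E x y x∈e y∈e x≢y)

      private-edge-next : ∀ {x} → In end x → finalLabel x < suc i → PrivateEdge end x
      private-edge-next {x} in-x ℓ<1+i with m<1+n⇒m<n∨m≡n ℓ<1+i
      ... | inj₁ ℓ<i = shrink (private-edge I (in-before in-x) ℓ<i)
      ... | inj₂ ℓ≡i with T? (candidate (nominated x))
      ...   | yes cand = candidate-private in-x cand
      ...   | no ¬cand = isolated-private (isolated-non-candidate (in-before in-x) ℓ≡i ¬cand)

      next : SweepInvariant (suc i)
      next = record
        { in⇒leader    = λ in-v → in⇒leader I (in-before in-v)
        ; covers       = covers-next
        ; private-edge = private-edge-next
        }

  sweep-initial : SweepInvariant 0
  sweep-initial = record
    { in⇒leader    = λ {v} in-v → T-leaderᵇ⁻ (subst T (proj₁ (flags-reducing L ≤-refl v)) in-v)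
    ; covers       = λ e∈E → let h , h∈e , hd = head-exists e∈E in
                       h , h∈e , subst T (sym (proj₁ (flags-reducing L ≤-refl h))) (T-leaderᵇ⁺ (head-leader e∈E h∈e hd))
    ; private-edge = λ _ ()
    }

  sweep-invariant : ∀ i → SweepInvariant i
  sweep-invariant zero    = sweep-initial
  sweep-invariant (suc i) = Phase.next i (sweep-invariant i)

  final : SweepInvariant palette
  final = sweep-invariant palette

  S : Subset n
  S = outputSet algorithm H 2 r ident col

  ∈S⁺ : ∀ {v} → ¬ In (sweepStart L palette) v → v ∈ S
  ∈S⁺ {v} out = lookup⇒[]= v S (trans (lookup∘tabulate _ v) (Equivalence.to T-≡ (T-not⁺ out)))

  ∈S⁻ : ∀ {v} → v ∈ S → ¬ In (sweepStart L palette) v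
  ∈S⁻ {v} v∈S = T-not⁻ (Equivalence.from T-≡ (trans (sym (lookup∘tabulate _ v)) ([]=⇒lookup v∈S)))

  independent : Independent H S
  independent = All.tabulate λ e∈E e⊆S → let y , y∈e , in-y = covers final e∈E in ∈S⁻ (e⊆S y∈e) in-y

  private-⊆ : ∀ {U x e} → S ⊆ U → x ∈ U → (∀ {y} → y ∈ e → In (sweepStart L palette) y → y ≡ x) → e ⊆ U
  private-⊆ {x = x} S⊆U x∈U only-x {y} y∈e with y ≟ᶠ x
  ... | yes refl = x∈U
  ... | no  y≢x  = S⊆U (∈S⁺ (λ in-y → y≢x (only-x y∈e in-y)))

  maximal : ∀ U → S ⊆ U → Independent H U → U ⊆ S
  maximal U S⊆U indep-U {x} x∈U = decidable-stable (x ∈? S) λ x∉S →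
    let in-x = decidable-stable (T? _) (λ out → x∉S (∈S⁺ out))
        e , e∈E , _ , only-x = private-edge final in-x (finalLabel-< (in⇒leader final in-x))
    in All.lookup indep-U e∈E (private-⊆ S⊆U x∈U only-x)

  maximalIndependent : MaximalIndependent H S
  maximalIndependent = independent , maximal

lemma33 : (C : ℕ) → Σ ℕ λ c → Σ LocalAlg λ A →
    ((n r : ℕ) → rounds A n 2 r ≤ c * log* (2 * r) + c) ×
    ((n : ℕ) (H : Hypergraph n) (r : ℕ) (ident col : Fin n → ℕ) →
      MaxDegree H 2 → Rank H r → Injective ident → ProperColoring H col →
      ((v : Fin n) → col v < C * (2 * r) ^ 2) →
      MaximalIndependent H (outputSet A H 2 r ident col))
lemma33 C =
  suc (palette * 2) , algorithm ,
  (λ n r → 1+a+L≤[1+a]*L+1+a (palette * 2) (log* (2 * r))) ,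
  λ n H r ident col maxDegree _ _ proper bounded →
    Correctness.maximalIndependent C H r ident col (proj₁ maxDegree) proper bounded
  where open Algorithm C
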